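{- Let $\mathcal M=(U,\mathcal L)$ be a COM and $A\subseteq U$. Then $\pi_A(G(\mathcal M))$ is the tope graph of $\mathcal M\setminus A$. If $X\in\mathcal L$, then the tope graph $[X]$ of $(U,F(X))$ is $U$-isomorphic to the tope graph $G(\mathcal M(X))=\pi_{\underline{X}}(G(\mathcal M))$ of $\mathcal M(X)=\mathcal M\setminus\underline{X}$.
   Context: Sign vectors $X:U\to\{ -1,0,+1\}$, support $\underline{X}=\{e:X_e\ne0\}$, composition $(X\circ Y)_e=X_e$ if $X_e\ne 0$ else $Y_e$, $\mathrm{Sep}(X,Y)=\{e:X_eY_e=-1\}$, and $X\le Y$ iff $X_e\in\{0,Y_e\}$ for all $e$. A COM $\mathcal M=(U,\mathcal L)$ is a set $\mathcal L\subseteq\{ -1,0,+1\}^U$ satisfying (FS) $X\circ(-Y)\in\mathcal L$ for all $X,Y\in\mathcal L$ and (SE) for $X,Y\in\mathcal L$, $e\in\mathrm{Sep}(X,Y)$ there is $Z\in\mathcal L$ with $Z_e=0$ and $Z_f=(X\circ Y)_f$ for $f\notin\mathrm{Sep}(X,Y)$; it is assumed simple (each coordinate takes all values $-1,0,+1$ on $\mathcal L$, and for $e\ne f$ there are $X,Y\in\mathcal L$ with $\{X_eX_f,Y_eY_f\}=\{+1,-1\}$). Topes are the maximal elements of $(\mathcal L,\le)$; the tope graph $G(\mathcal M)$ has the topes as vertices, adjacent iff they differ in exactly one coordinate. For $X\in\mathcal L$, $F(X)=\{Y\in\mathcal L:X\le Y\}$ and $[X]$ is the subgraph of $G(\mathcal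 M)$ induced by the topes in $F(X)$. For $A\subseteq U$, $X\setminus A$ is the restriction of $X$ to $U\setminus A$, $\mathcal M\setminus A=(U\setminus A,\{X\setminus A:X\in\mathcal L\})$, and $\mathcal M(X)=\mathcal M\setminus\underline X$. For a graph $G$ whose vertices are $\{\pm1\}$-vectors on $U$ and $A\subseteq U$, $\pi_A(G)$ is the graph obtained by contracting all edges whose endpoints differ in a coordinate of $A$; i.e. its vertices are $\{v\setminus A: v\in V(G)\}$ and two are adjacent iff they are images of adjacent vertices of $G$. For $e\in U$, the $\Theta$-class $E_e$ of such a graph is the set of its edges whose endpoints differ in coordinate $e$. If $G$ is an isometric subgraph of the hypercube on $\{\pm1\}^U$ and $H$ of the hypercube on $\{\pm1\}^{U\setminus A}$, they are $U$-isomorphic if there is a graph isomorphism $G\to H$ mapping each edge of $E_e$ of $G$ to an edge of $E_e$ of $H$. -}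

module Defs where

open import Data.Nat using (ℕ)
open import Data.Fin using (Fin)
open import Data.Fin.Subset using (Subset)
open import Data.Bool using (Bool; true; false; if_then_else_)
open import Data.Vec using (lookup; tabulate)
open import Data.List using (List; map)
open import Data.List.Relation.Unary.Any using (Any)
open import Data.Product using (Σ; ∃; ∃-syntax; _×_; _,_)
open import Data.Sum using (_⊎_)
open import Relation.Binary.PropositionalEquality using (_≡_; _≢_)
open import Relation.Nullary using (¬_)
open import Function.Bundles using (_⇔_)

data Sign : Set where
  neg zer pos : Sign

-_ˢ : Sign → Sign
- neg ˢ = pos
- zer ˢ = zer
- pos ˢ = neg

_·ˢ_ : Sign → Sign → Sign
zer ·ˢ _ = zer
_ ·ˢ zer = zer
pos ·ˢ pos = pos
neg ·ˢ neg = pos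
pos ·ˢ neg = neg
neg ·ˢ pos = neg

isNonzero : Sign → Bool
isNonzero zer = false
isNonzero _ = true

-- Sign vectors on the ground set U = Fin n
SV : ℕ → Set
SV n = Fin n → Sign

module _ {n : ℕ} where

  _≐_ : SV n → SV n → Set
  X ≐ Y = ∀ e → X e ≡ Y e

  supp : SV n → Subset n
  supp X = tabulate (λ e → isNonzero (X e))

  -ᵛ_ : SV n → SV n
  (-ᵛ X) e = - (X e) ˢ

  _∘ᵛ_ : SV n → SV n → SV n
  (X ∘ᵛ Y) e with X e
  ... | zer = Y e
  ... | s = s

  Sep : SV n → SV n → Fin n → Set
  Sep X Y e = (X e ·ˢ Y e) ≡ neg

  _≤ᵛ_ : SV n → SV n → Set
  X ≤ᵛ Y = ∀ e → (X e ≡ zer) ⊎ (X e ≡ Y e)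

  SignSystem : Set
  SignSystem = List (SV n)

  _∈ᴸ_ : SV n → SignSystem → Set
  X ∈ᴸ L = Any (λ Y → Y ≐ X) L

  FS : SignSystem → Set
  FS L = ∀ X Y → X ∈ᴸ L → Y ∈ᴸ L → (X ∘ᵛ (-ᵛ Y)) ∈ᴸ L

  SE : SignSystem → Set
  SE L = ∀ X Y → X ∈ᴸ L → Y ∈ᴸ L → ∀ e → Sep X Y e →
         ∃[ Z ] (Z ∈ᴸ L × Z e ≡ zer × (∀ f → ¬ Sep X Y f → Z f ≡ (X ∘ᵛ Y) f))

  Simple : SignSystem → Set
  Simple L =
    (∀ e (s : Sign) → ∃[ X ] (X ∈ᴸ L × X e ≡ s)) ×
    (∀ e f → e ≢ f → ∃[ X ] ∃[ Y ] (X ∈ᴸ L × Y ∈ᴸ L × (X e ·ˢ X f) ≡ pos × (Y e ·ˢ Y f) ≡ neg))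

  record IsCOM (L : SignSystem) : Set where
    field
      fs : FS L
      se : SE L
      simple : Simple L

  Tope : SignSystem → SV n → Set
  Tope L T = T ∈ᴸ L × (∀ Y → Y ∈ᴸ L → T ≤ᵛ Y → Y ≐ T)

  DiffOne : SV n → SV n → Set
  DiffOne X Y = ∃[ e ] (X e ≢ Y e × (∀ f → X f ≢ Y f → f ≡ e))

  record Graph : Set₁ where
    field
      Vert : SV n → Set
      Adj  : SV n → SV n → Set

  open Graph public

  TopeGraph : SignSystem → Graph
  TopeGraph L = record
    { Vert = Tope L
    ; Adj  = λ X Y → Tope L X × Tope L Y × DiffOne X Y }

  -- Restriction / deletion.  Sign vectors on U \ A are encoded as sign
  -- vectors on U that vanish on A (coordinates in A are set to 0).
  restrict : Subset n → SV n → SV n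
  restrict A X e = if lookup A e then zer else X e

  delete : SignSystem → Subset n → SignSystem
  delete L A = map (restrict A) L

  FaceGraph : SignSystem → SV n → Graph
  FaceGraph L X = record
    { Vert = λ T → Tope L T × X ≤ᵛ T
    ; Adj  = λ T T' → (Tope L T × X ≤ᵛ T) × (Tope L T' × X ≤ᵛ T') × DiffOne T T' }

  -- π_A(G): contract all edges whose endpoints differ in a coordinate of A
  contract : Subset n → Graph → Graph
  contract A G = record
    { Vert = λ w → ∃[ v ] (Vert G v × restrict A v ≐ w)
    ; Adj  = λ u w → ¬ (u ≐ w) ×
        ∃[ v ] ∃[ v' ] (Adj G v v' × restrict A v ≐ u × restrict A v' ≐ w) }

  SameGraph : Graph → Graph → Set
  SameGraph G H = (∀ v → Vert G v ⇔ Vert H v) × (∀ u w → Adj G u w ⇔ Adj H u w)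

  -- U-isomorphism: graph isomorphism mapping each Θ-class E_e into E_e
  record UIso (G H : Graph) : Set where
    field
      φ        : SV n → SV n
      φ-cong   : ∀ u v → Vert G u → u ≐ v → φ u ≐ φ v
      φ-vert   : ∀ v → Vert G v → Vert H (φ v)
      φ-inj    : ∀ u v → Vert G u → Vert G v → φ u ≐ φ v → u ≐ v
      φ-surj   : ∀ w → Vert H w → ∃[ v ] (Vert G v × φ v ≐ w)
      φ-adj    : ∀ u v → Vert G u → Vert G v → Adj G u v ⇔ Adj H (φ u) (φ v)
      φ-Θ      : ∀ u v → Adj G u v → ∀ e → u e ≢ v e → φ u e ≢ φ v e

-- π_A(G(M)) has as vertices the restrictions of topes of M, and these are exactly the topes of
-- M \ A because every covector lies below a tope.  For the edges, an edge of G(M \ A) at e lifts to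
-- topes v, v' differing only at e and inside A, and we need an edge of G(M) at e whose ends restrict
-- like v and v'.  It comes from the partial-cube property of COM tope graphs: every tope T has a
-- neighbour in the direction of any other tope T', because strong elimination produces a tope R with
-- ∅ ≠ Sep(T, R) ⊊ Sep(T, T').  Walking from v to v' through such neighbours, the step that crosses e
-- is the required edge.  For the face [X], deleting supp X is injective on the topes above X, and a
-- tope of M(X) restricted from v is also restricted from the tope X ∘ v above X.
module Submission where

open import Defs
open import Data.Nat using (ℕ)
open import Data.Fin using (Fin) renaming (_≟_ to _≟ᶠ_)
open import Data.Fin.Properties using (any?; ¬∀⟶∃¬)
open import Data.Fin.Subset using (Subset; _∈_; _⊂_)
open import Data.Fin.Subset.Induction using (Acc; acc; ⊂-wellFounded)
open import Data.Bool using (true; false)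
open import Data.Vec using (lookup; tabulate)
open import Data.Vec.Properties using (lookup∘tabulate; lookup⇒[]=; []=⇒lookup)
open import Data.List using (List; []; _∷_; allFin)
import Data.List.Relation.Unary.Any as Any
open import Data.List.Relation.Unary.Any using (here; there)
open import Data.List.Relation.Unary.Any.Properties using (map⁺; map⁻)
open import Data.List.Membership.Propositional using (find) renaming (_∈_ to _∈ˡ_)
open import Data.List.Membership.Propositional.Properties using (∈-allFin)
open import Data.Product using (∃-syntax; _×_; _,_; proj₁; proj₂; map₁)
open import Data.Sum using (_⊎_; inj₁; inj₂; [_,_]′; map₂)
open import Relation.Nullary using (does; ¬_; yes; no; ¬?; _×-dec_; contradiction)
open import Relation.Nullary.Decidable using (dec-true; dec-false; decidable-stable)
open import Relation.Binary.Definitions using (DecidableEquality)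
open import Relation.Binary.PropositionalEquality using (_≡_; _≢_; refl; sym; trans; cong; cong₂; subst)
open import Function.Bundles using (mk⇔; Equivalence)

infix 4 _≟ˢ_

_≟ˢ_ : DecidableEquality Sign
neg ≟ˢ neg = yes refl
neg ≟ˢ zer = no λ ()
neg ≟ˢ pos = no λ ()
zer ≟ˢ neg = no λ ()
zer ≟ˢ zer = yes refl
zer ≟ˢ pos = no λ ()
pos ≟ˢ neg = no λ ()
pos ≟ˢ zer = no λ ()
pos ≟ˢ pos = yes refl

≢ˢ-stable : ∀ {a b : Sign} → ¬ a ≢ b → a ≡ b
≢ˢ-stable = decidable-stable (_ ≟ˢ _)

-ˢ-involutive : ∀ a → - (- a ˢ) ˢ ≡ a
-ˢ-involutive neg = refl
-ˢ-involutive zer = refl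
-ˢ-involutive pos = refl

-ˢ-·ˢ-cancel : ∀ a b → (- a ˢ) ·ˢ (- b ˢ) ≡ a ·ˢ b
-ˢ-·ˢ-cancel zer _   = refl
-ˢ-·ˢ-cancel neg zer = refl
-ˢ-·ˢ-cancel pos zer = refl
-ˢ-·ˢ-cancel neg neg = refl
-ˢ-·ˢ-cancel neg pos = refl
-ˢ-·ˢ-cancel pos neg = refl
-ˢ-·ˢ-cancel pos pos = refl

·ˢ-nonzero : ∀ a b → a ·ˢ b ≢ zer → a ≢ zer × b ≢ zer
·ˢ-nonzero zer _   ab≢0 = contradiction refl ab≢0
·ˢ-nonzero neg zer ab≢0 = contradiction refl ab≢0
·ˢ-nonzero pos zer ab≢0 = contradiction refl ab≢0
·ˢ-nonzero neg neg _    = (λ ()) , (λ ())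
·ˢ-nonzero neg pos _    = (λ ()) , (λ ())
·ˢ-nonzero pos neg _    = (λ ()) , (λ ())
·ˢ-nonzero pos pos _    = (λ ()) , (λ ())

·ˢ-self≢neg : ∀ a → a ·ˢ a ≢ neg
·ˢ-self≢neg neg ()
·ˢ-self≢neg zer ()
·ˢ-self≢neg pos ()

opposite-sign : ∀ {a b} → a ≢ zer → b ≢ zer → a ≢ b → b ≡ - a ˢ
opposite-sign {neg} {neg} _   _   a≢b = contradiction refl a≢b
opposite-sign {neg} {pos} _   _   _   = refl
opposite-sign {pos} {neg} _   _   _   = refl
opposite-sign {pos} {pos} _   _   a≢b = contradiction refl a≢b
opposite-sign {zer}       a≢0 _   _   = contradiction refl a≢0
opposite-sign {_}   {zer} _   b≢0 _   = contradiction refl b≢0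

third-sign : ∀ {a b c} → a ≢ zer → b ≢ zer → c ≢ zer → a ≢ b → a ≢ c → c ≡ b
third-sign a≢0 b≢0 c≢0 a≢b a≢c = trans (opposite-sign a≢0 c≢0 a≢c) (sym (opposite-sign a≢0 b≢0 a≢b))

·ˢ-opposite : ∀ {a b} → a ≢ zer → b ≢ zer → a ≢ b → a ·ˢ b ≡ neg
·ˢ-opposite {neg} {neg} _   _   a≢b = contradiction refl a≢b
·ˢ-opposite {neg} {pos} _   _   _   = refl
·ˢ-opposite {pos} {neg} _   _   _   = refl
·ˢ-opposite {pos} {pos} _   _   a≢b = contradiction refl a≢b
·ˢ-opposite {zer}       a≢0 _   _   = contradiction refl a≢0
·ˢ-opposite {_}   {zer} _   b≢0 _   = contradiction refl b≢0

-- With four nonzero signs, changing both factors of a product does not change it.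
·ˢ-≢⇒one-agrees : ∀ {a b c d} → a ≢ zer → b ≢ zer → c ≢ zer → d ≢ zer → a ·ˢ b ≢ c ·ˢ d →
                  (a ≡ c × b ≢ d) ⊎ (a ≢ c × b ≡ d)
·ˢ-≢⇒one-agrees {a} {b} {c} {d} a≢0 b≢0 c≢0 d≢0 ab≢cd with a ≟ˢ c | b ≟ˢ d
... | yes refl | yes refl = contradiction refl ab≢cd
... | yes a≡c  | no b≢d   = inj₁ (a≡c , b≢d)
... | no a≢c   | yes b≡d  = inj₂ (a≢c , b≡d)
... | no a≢c   | no b≢d   = contradiction (sym cd≡ab) ab≢cd
  where
  cd≡ab : c ·ˢ d ≡ a ·ˢ b
  cd≡ab = trans (cong₂ _·ˢ_ (opposite-sign a≢0 c≢0 a≢c) (opposite-sign b≢0 d≢0 b≢d)) (-ˢ-·ˢ-cancel a b)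

module _ {n : ℕ} where

  ≐-refl : {X : SV n} → X ≐ X
  ≐-refl _ = refl

  ≐-trans : {X Y Z : SV n} → X ≐ Y → Y ≐ Z → X ≐ Z
  ≐-trans X≐Y Y≐Z e = trans (X≐Y e) (Y≐Z e)

  ≐-sym : {X Y : SV n} → X ≐ Y → Y ≐ X
  ≐-sym X≐Y e = sym (X≐Y e)

  ≢-resp-≐ : ∀ {X X' Y Y' : SV n} → X ≐ X' → Y ≐ Y' → ∀ e → X e ≢ Y e → X' e ≢ Y' e
  ≢-resp-≐ X≐X' Y≐Y' e Xe≢Ye X'e≡Y'e = Xe≢Ye (trans (X≐X' e) (trans X'e≡Y'e (sym (Y≐Y' e))))

  Total : SV n → Set
  Total X = ∀ e → X e ≢ zer

  ∘ᵛ-zer : ∀ (X Y : SV n) e → X e ≡ zer → (X ∘ᵛ Y) e ≡ Y e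
  ∘ᵛ-zer X Y e Xe≡0 rewrite Xe≡0 = refl

  ∘ᵛ-nonzero : ∀ (X Y : SV n) e → X e ≢ zer → (X ∘ᵛ Y) e ≡ X e
  ∘ᵛ-nonzero X Y e Xe≢0 with X e
  ... | neg = refl
  ... | zer = contradiction refl Xe≢0
  ... | pos = refl

  ∘ᵛ-nonzeroʳ : ∀ (X Y : SV n) e → Y e ≢ zer → (X ∘ᵛ Y) e ≢ zer
  ∘ᵛ-nonzeroʳ X Y e Ye≢0 with X e ≟ˢ zer
  ... | yes Xe≡0 = λ XYe≡0 → Ye≢0 (trans (sym (∘ᵛ-zer X Y e Xe≡0)) XYe≡0)
  ... | no Xe≢0  = λ XYe≡0 → Xe≢0 (trans (sym (∘ᵛ-nonzero X Y e Xe≢0)) XYe≡0)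

  ∘ᵛ-total : ∀ (X Y : SV n) → Total Y → Total (X ∘ᵛ Y)
  ∘ᵛ-total X Y Y-total e = ∘ᵛ-nonzeroʳ X Y e (Y-total e)

  ∘ᵛ-via-negation : ∀ (X Y : SV n) → (X ∘ᵛ (-ᵛ (X ∘ᵛ (-ᵛ Y)))) ≐ (X ∘ᵛ Y)
  ∘ᵛ-via-negation X Y e with X e ≟ˢ zer
  ... | no Xe≢0  = trans (∘ᵛ-nonzero X (-ᵛ (X ∘ᵛ (-ᵛ Y))) e Xe≢0) (sym (∘ᵛ-nonzero X Y e Xe≢0))
  ... | yes Xe≡0 = trans (∘ᵛ-zer X (-ᵛ (X ∘ᵛ (-ᵛ Y))) e Xe≡0)
                     (trans (cong -_ˢ (∘ᵛ-zer X (-ᵛ Y) e Xe≡0))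
                       (trans (-ˢ-involutive (Y e)) (sym (∘ᵛ-zer X Y e Xe≡0))))

  ≤ᵛ-refl : {X : SV n} → X ≤ᵛ X
  ≤ᵛ-refl _ = inj₂ refl

  ≤ᵛ-trans : {X Y Z : SV n} → X ≤ᵛ Y → Y ≤ᵛ Z → X ≤ᵛ Z
  ≤ᵛ-trans X≤Y Y≤Z e with X≤Y e | Y≤Z e
  ... | inj₁ Xe≡0  | _          = inj₁ Xe≡0
  ... | inj₂ Xe≡Ye | inj₁ Ye≡0  = inj₁ (trans Xe≡Ye Ye≡0)
  ... | inj₂ Xe≡Ye | inj₂ Ye≡Ze = inj₂ (trans Xe≡Ye Ye≡Ze)

  ≤ᵛ-∘ᵛ : ∀ (X Y : SV n) → X ≤ᵛ (X ∘ᵛ Y)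
  ≤ᵛ-∘ᵛ X Y e with X e ≟ˢ zer
  ... | yes Xe≡0 = inj₁ Xe≡0
  ... | no Xe≢0  = inj₂ (sym (∘ᵛ-nonzero X Y e Xe≢0))

  ≤ᵛ-nonzero : ∀ {X Y : SV n} → X ≤ᵛ Y → ∀ e → X e ≢ zer → Y e ≡ X e
  ≤ᵛ-nonzero X≤Y e Xe≢0 with X≤Y e
  ... | inj₁ Xe≡0  = contradiction Xe≡0 Xe≢0
  ... | inj₂ Xe≡Ye = sym Xe≡Ye

  ≤ᵛ-disagree : ∀ {X u v : SV n} → X ≤ᵛ u → X ≤ᵛ v → ∀ e → u e ≢ v e → X e ≡ zer
  ≤ᵛ-disagree X≤u X≤v e ue≢ve with X≤u e | X≤v e
  ... | inj₁ Xe≡0  | _          = Xe≡0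
  ... | inj₂ _     | inj₁ Xe≡0  = Xe≡0
  ... | inj₂ Xe≡ue | inj₂ Xe≡ve = contradiction (trans (sym Xe≡ue) Xe≡ve) ue≢ve

  DiffOnlyAt : SV n → SV n → Fin n → Set
  DiffOnlyAt X Y e = X e ≢ Y e × (∀ f → X f ≢ Y f → f ≡ e)

  DiffOnlyAt-agree : ∀ {X Y g} → DiffOnlyAt X Y g → ∀ j → j ≢ g → X j ≡ Y j
  DiffOnlyAt-agree (_ , only-g) j j≢g = ≢ˢ-stable λ Xj≢Yj → j≢g (only-g j Xj≢Yj)

  DiffOnlyAt-cong : ∀ {X X' Y Y' e} → X ≐ X' → Y ≐ Y' → DiffOnlyAt X Y e → DiffOnlyAt X' Y' e
  DiffOnlyAt-cong {e = e} X≐X' Y≐Y' (Xe≢Ye , only-e) =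
    ≢-resp-≐ X≐X' Y≐Y' e Xe≢Ye , λ f X'f≢Y'f → only-e f (≢-resp-≐ (≐-sym X≐X') (≐-sym Y≐Y') f X'f≢Y'f)

  -- On topes, which are total, diff T T' is Sep(T, T').
  diff : SV n → SV n → Subset n
  diff X Y = tabulate λ e → does (¬? (X e ≟ˢ Y e))

  ∈-diff⁺ : ∀ (X Y : SV n) e → X e ≢ Y e → e ∈ diff X Y
  ∈-diff⁺ X Y e Xe≢Ye =
    lookup⇒[]= e _ (trans (lookup∘tabulate _ e) (dec-true (¬? (X e ≟ˢ Y e)) Xe≢Ye))

  ∈-diff⁻ : ∀ (X Y : SV n) e → e ∈ diff X Y → X e ≢ Y e
  ∈-diff⁻ X Y e e∈diff Xe≡Ye = contradiction (trans (sym does≡false) does≡true) λ ()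
    where
    does≡true : does (¬? (X e ≟ˢ Y e)) ≡ true
    does≡true = trans (sym (lookup∘tabulate _ e)) ([]=⇒lookup e∈diff)
    does≡false : does (¬? (X e ≟ˢ Y e)) ≡ false
    does≡false = dec-false (¬? (X e ≟ˢ Y e)) λ Xe≢Ye → Xe≢Ye Xe≡Ye

  diff-⊂ : ∀ (X Y X' Y' : SV n) → (∀ e → X e ≢ Y e → X' e ≢ Y' e) →
           ∀ a → X a ≡ Y a → X' a ≢ Y' a → diff X Y ⊂ diff X' Y'
  diff-⊂ X Y X' Y' sub a Xa≡Ya X'a≢Y'a =
    (λ {e} e∈ → ∈-diff⁺ X' Y' e (sub e (∈-diff⁻ X Y e e∈))) ,
    a , ∈-diff⁺ X' Y' a X'a≢Y'a , λ a∈ → ∈-diff⁻ X Y a a∈ Xa≡Ya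

  restrict-inside : ∀ (A : Subset n) (X : SV n) e → lookup A e ≡ true → restrict A X e ≡ zer
  restrict-inside A X e e∈A rewrite e∈A = refl

  restrict-outside : ∀ (A : Subset n) (X : SV n) e → lookup A e ≡ false → restrict A X e ≡ X e
  restrict-outside A X e e∉A rewrite e∉A = refl

  restrict-≐ : ∀ (A : Subset n) {X Y : SV n} → (∀ e → lookup A e ≡ false → X e ≡ Y e) →
               restrict A X ≐ restrict A Y
  restrict-≐ A agree e with lookup A e in e∈?A
  ... | true  = refl
  ... | false = agree e e∈?A

  restrict-≐⁻ : ∀ (A : Subset n) {X Y : SV n} → restrict A X ≐ restrict A Y → ∀ e → lookup A e ≡ false →
                X e ≡ Y e
  restrict-≐⁻ A {X} {Y} XA≐YA e e∉A =
    trans (sym (restrict-outside A X e e∉A)) (trans (XA≐YA e) (restrict-outside A Y e e∉A))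

  restrict-cong : ∀ (A : Subset n) {X Y : SV n} → X ≐ Y → restrict A X ≐ restrict A Y
  restrict-cong A X≐Y = restrict-≐ A λ e _ → X≐Y e

  ≤ᵛ-restrict : ∀ (A : Subset n) {X Y : SV n} → X ≤ᵛ Y → restrict A X ≤ᵛ restrict A Y
  ≤ᵛ-restrict A X≤Y e with lookup A e
  ... | true  = inj₁ refl
  ... | false = X≤Y e

  restrict-≢⁻ : ∀ (A : Subset n) (X Y : SV n) e → restrict A X e ≢ restrict A Y e →
                X e ≢ Y e × lookup A e ≡ false
  restrict-≢⁻ A X Y e ne with lookup A e
  ... | true  = contradiction refl ne
  ... | false = ne , refl

  restrict-≢⁺ : ∀ (A : Subset n) (X Y : SV n) e → lookup A e ≡ false → X e ≢ Y e →
                restrict A X e ≢ restrict A Y e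
  restrict-≢⁺ A X Y e e∉A Xe≢Ye rewrite e∉A = Xe≢Ye

  restrict-DiffOnlyAt : ∀ (A : Subset n) (X Y : SV n) e → lookup A e ≡ false → DiffOnlyAt X Y e →
                        DiffOnlyAt (restrict A X) (restrict A Y) e
  restrict-DiffOnlyAt A X Y e e∉A (Xe≢Ye , only-e) =
    restrict-≢⁺ A X Y e e∉A Xe≢Ye , λ f ne → only-e f (proj₁ (restrict-≢⁻ A X Y f ne))

  restrict-DiffOnlyAt⁻ : ∀ (A : Subset n) (X Y : SV n) e → (∀ f → X f ≢ Y f → lookup A f ≡ false) →
                         DiffOnlyAt (restrict A X) (restrict A Y) e → DiffOnlyAt X Y e
  restrict-DiffOnlyAt⁻ A X Y e outside (ne , only-e) =
    proj₁ (restrict-≢⁻ A X Y e ne) ,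
    λ f Xf≢Yf → only-e f (restrict-≢⁺ A X Y f (outside f Xf≢Yf) Xf≢Yf)

  supp-zer : ∀ (X : SV n) e → X e ≡ zer → lookup (supp X) e ≡ false
  supp-zer X e Xe≡0 = trans (lookup∘tabulate _ e) (cong isNonzero Xe≡0)

  supp-zer⁻ : ∀ (X : SV n) e → lookup (supp X) e ≡ false → X e ≡ zer
  supp-zer⁻ X e e∉supp = isNonzero-false (trans (sym (lookup∘tabulate _ e)) e∉supp)
    where
    isNonzero-false : ∀ {s} → isNonzero s ≡ false → s ≡ zer
    isNonzero-false {zer} _ = refl
    isNonzero-false {neg} ()
    isNonzero-false {pos} ()

  ≤ᵛ-disagree-supp : ∀ {X u v : SV n} → X ≤ᵛ u → X ≤ᵛ v → ∀ e → u e ≢ v e → lookup (supp X) e ≡ false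
  ≤ᵛ-disagree-supp {X} X≤u X≤v e ue≢ve = supp-zer X e (≤ᵛ-disagree X≤u X≤v e ue≢ve)

  face-restrict-injective : ∀ {X u v : SV n} → X ≤ᵛ u → X ≤ᵛ v →
                            restrict (supp X) u ≐ restrict (supp X) v → u ≐ v
  face-restrict-injective {X} X≤u X≤v uX≐vX e with X e ≟ˢ zer
  ... | yes Xe≡0 = restrict-≐⁻ (supp X) uX≐vX e (supp-zer X e Xe≡0)
  ... | no Xe≢0  = trans (≤ᵛ-nonzero X≤u e Xe≢0) (sym (≤ᵛ-nonzero X≤v e Xe≢0))

  ∈ᴸ-cong : ∀ {L : SignSystem {n}} {X Y} → X ∈ᴸ L → X ≐ Y → Y ∈ᴸ L
  ∈ᴸ-cong X∈L X≐Y = Any.map (λ Z≐X → ≐-trans Z≐X X≐Y) X∈L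

  ∈-delete⁺ : ∀ {L : SignSystem {n}} (A : Subset n) {X W} → X ∈ᴸ L → restrict A X ≐ W → W ∈ᴸ delete L A
  ∈-delete⁺ A X∈L XA≐W = ∈ᴸ-cong (map⁺ (Any.map (restrict-cong A) X∈L)) XA≐W

  ∈-delete⁻ : ∀ {L : SignSystem {n}} (A : Subset n) {W} → W ∈ᴸ delete L A →
              ∃[ X ] (X ∈ᴸ L × restrict A X ≐ W)
  ∈-delete⁻ A W∈ with find (map⁻ W∈)
  ... | X , X∈L , XA≐W = X , Any.map (λ { refl _ → refl }) X∈L , XA≐W

  SameGraph-sym : ∀ {G H : Graph {n}} → SameGraph G H → SameGraph H G
  SameGraph-sym (same-vert , same-adj) =
    (λ v → mk⇔ (Equivalence.from (same-vert v)) (Equivalence.to (same-vert v))) ,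
    (λ u w → mk⇔ (Equivalence.from (same-adj u w)) (Equivalence.to (same-adj u w)))

module COM {n : ℕ} {L : SignSystem {n}} (com : IsCOM L) where
  open IsCOM com

  ∘ᵛ-∈ : ∀ {X Y} → X ∈ᴸ L → Y ∈ᴸ L → (X ∘ᵛ Y) ∈ᴸ L
  ∘ᵛ-∈ {X} {Y} X∈L Y∈L = ∈ᴸ-cong (fs X (X ∘ᵛ (-ᵛ Y)) X∈L (fs X Y X∈L Y∈L)) (∘ᵛ-via-negation X Y)

  total-above-on : ∀ (es : List (Fin n)) {Y} → Y ∈ᴸ L →
                   ∃[ T ] (T ∈ᴸ L × Y ≤ᵛ T × (∀ {e} → e ∈ˡ es → T e ≢ zer))
  total-above-on []       Y∈L = _ , Y∈L , ≤ᵛ-refl , λ ()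
  total-above-on (e ∷ es) Y∈L with total-above-on es Y∈L | proj₁ simple e pos
  ... | T , T∈L , Y≤T , T≢0 | P , P∈L , Pe≡pos =
    T ∘ᵛ P , ∘ᵛ-∈ T∈L P∈L , ≤ᵛ-trans Y≤T (≤ᵛ-∘ᵛ T P) , nonzero
    where
    nonzero : ∀ {f} → f ∈ˡ e ∷ es → (T ∘ᵛ P) f ≢ zer
    nonzero (here refl) = ∘ᵛ-nonzeroʳ T P e λ Pe≡0 → contradiction (trans (sym Pe≡pos) Pe≡0) λ ()
    nonzero {f} (there f∈es) TPf≡0 = T≢0 f∈es (trans (sym (∘ᵛ-nonzero T P f (T≢0 f∈es))) TPf≡0)

  total-above : ∀ {Y} → Y ∈ᴸ L → ∃[ T ] (T ∈ᴸ L × Y ≤ᵛ T × Total T)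
  total-above Y∈L with total-above-on (allFin n) Y∈L
  ... | T , T∈L , Y≤T , T≢0 = T , T∈L , Y≤T , λ e → T≢0 (∈-allFin e)

  total⇒tope : ∀ {T} → T ∈ᴸ L → Total T → Tope L T
  total⇒tope T∈L T-total = T∈L , λ Y _ T≤Y e → ≤ᵛ-nonzero T≤Y e (T-total e)

  tope⇒total : ∀ {T} → Tope L T → Total T
  tope⇒total (T∈L , maximal) e Te≡0 with total-above T∈L
  ... | T' , T'∈L , T≤T' , T'-total = T'-total e (trans (maximal T' T'∈L T≤T' e) Te≡0)

  tope-above : ∀ {Y} → Y ∈ᴸ L → ∃[ T ] (Tope L T × Y ≤ᵛ T)
  tope-above Y∈L with total-above Y∈L
  ... | T , T∈L , Y≤T , T-total = T , total⇒tope T∈L T-total , Y≤T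

  ∘ᵛ-tope : ∀ {X T} → X ∈ᴸ L → Tope L T → Tope L (X ∘ᵛ T)
  ∘ᵛ-tope {X} {T} X∈L tT = total⇒tope (∘ᵛ-∈ X∈L (proj₁ tT)) (∘ᵛ-total X T (tope⇒total tT))

  restrict-tope : ∀ A {T W} → Tope L T → restrict A T ≐ W → Tope (delete L A) W
  restrict-tope A {T} {W} tT TA≐W = ∈-delete⁺ A (proj₁ tT) TA≐W , maximal
    where
    maximal : ∀ Y → Y ∈ᴸ delete L A → W ≤ᵛ Y → Y ≐ W
    maximal Y Y∈ W≤Y e with ∈-delete⁻ A Y∈ | lookup A e in e∈?A
    ... | X , _ , XA≐Y | true  = trans (sym (XA≐Y e)) (trans (restrict-inside A X e e∈?A)
                                   (trans (sym (restrict-inside A T e e∈?A)) (TA≐W e)))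
    ... | _ , _ , _    | false = ≤ᵛ-nonzero W≤Y e λ We≡0 →
                                   tope⇒total tT e (trans (sym (restrict-outside A T e e∈?A)) (trans (TA≐W e) We≡0))

  tope-lift : ∀ A {W} → Tope (delete L A) W → ∃[ T ] (Tope L T × restrict A T ≐ W)
  tope-lift A {W} (W∈ , maximal) with ∈-delete⁻ A W∈
  ... | Y , Y∈L , YA≐W with tope-above Y∈L
  ... | T , tT , Y≤T = T , tT , maximal _ (∈-delete⁺ A (proj₁ tT) ≐-refl) W≤TA
    where
    W≤TA : W ≤ᵛ restrict A T
    W≤TA = ≤ᵛ-trans (λ e → inj₂ (sym (YA≐W e))) (≤ᵛ-restrict A Y≤T)

  DescentStep : SV n → SV n → Set
  DescentStep T T' = ∃[ R ] (Tope L R × diff T R ⊂ diff T T' × ∃[ b ] (T b ≢ R b))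

  descent-above : ∀ {T T' Z R} → Tope L T → (∀ j → T j ≡ T' j → Z j ≡ T j) → Tope L R → Z ≤ᵛ R →
                  ∀ a b → T a ≡ R a → T a ≢ T' a → T b ≢ R b → DescentStep T T'
  descent-above {T} {T'} {Z} {R} tT Z-agrees tR Z≤R a b Ta≡Ra Ta≢T'a Tb≢Rb =
    R , tR , diff-⊂ T R T T' moves-inside a Ta≡Ra Ta≢T'a , b , Tb≢Rb
    where
    moves-inside : ∀ j → T j ≢ R j → T j ≢ T' j
    moves-inside j Tj≢Rj Tj≡T'j = Tj≢Rj (sym (trans (≤ᵛ-nonzero Z≤R j Zj≢0) Zj≡Tj))
      where
      Zj≡Tj = Z-agrees j Tj≡T'j
      Zj≢0 = λ Zj≡0 → tope⇒total tT j (trans (sym Zj≡Tj) Zj≡0)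

  separating-vector : ∀ {f h} → f ≢ h → ∀ s → ∃[ V ] (V ∈ᴸ L × (V f ≢ zer × V h ≢ zer) × V f ·ˢ V h ≢ s)
  separating-vector {f} {h} f≢h s with proj₂ simple f h f≢h | s ≟ˢ pos
  ... | _ , Y , _ , Y∈L , _ , YfYh≡neg | yes s≡pos =
    Y , Y∈L , ·ˢ-nonzero (Y f) (Y h) (λ eq → contradiction (trans (sym YfYh≡neg) eq) λ ()) ,
    λ eq → contradiction (trans (sym YfYh≡neg) (trans eq s≡pos)) λ ()
  ... | X , _ , X∈L , _ , XfXh≡pos , _ | no s≢pos =
    X , X∈L , ·ˢ-nonzero (X f) (X h) (λ eq → contradiction (trans (sym XfXh≡pos) eq) λ ()) ,
    λ eq → s≢pos (trans (sym eq) XfXh≡pos)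

  -- A tope above Z ∘ V with V f V h ≠ T f T h agrees with T at exactly one of f and h.
  descent-via-zero : ∀ {T T' Z} → Tope L T → ∀ {f h} → f ≢ h → T f ≢ T' f → T h ≢ T' h →
                     Z ∈ᴸ L → Z f ≡ zer → Z h ≡ zer → (∀ j → T j ≡ T' j → Z j ≡ T j) → DescentStep T T'
  descent-via-zero {T} {T'} {Z} tT {f} {h} f≢h Tf≢T'f Th≢T'h Z∈L Zf≡0 Zh≡0 Z-agrees
    with separating-vector f≢h (T f ·ˢ T h)
  ... | V , V∈L , (Vf≢0 , Vh≢0) , VfVh≢TfTh with tope-above (∘ᵛ-∈ Z∈L V∈L)
  ... | R , tR , ZV≤R =
    [ f-agrees , h-agrees ]′ (·ˢ-≢⇒one-agrees Vf≢0 Vh≢0 (tope⇒total tT f) (tope⇒total tT h) VfVh≢TfTh)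
    where
    Z≤R : Z ≤ᵛ R
    Z≤R = ≤ᵛ-trans (≤ᵛ-∘ᵛ Z V) ZV≤R
    R≡V : ∀ j → Z j ≡ zer → V j ≢ zer → R j ≡ V j
    R≡V j Zj≡0 Vj≢0 = trans (≤ᵛ-nonzero ZV≤R j (∘ᵛ-nonzeroʳ Z V j Vj≢0)) (∘ᵛ-zer Z V j Zj≡0)
    f-agrees : V f ≡ T f × V h ≢ T h → DescentStep T T'
    f-agrees (Vf≡Tf , Vh≢Th) =
      descent-above tT Z-agrees tR Z≤R f h (sym (trans (R≡V f Zf≡0 Vf≢0) Vf≡Tf)) Tf≢T'f
        λ Th≡Rh → Vh≢Th (sym (trans Th≡Rh (R≡V h Zh≡0 Vh≢0)))
    h-agrees : V f ≢ T f × V h ≡ T h → DescentStep T T'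
    h-agrees (Vf≢Tf , Vh≡Th) =
      descent-above tT Z-agrees tR Z≤R h f (sym (trans (R≡V h Zh≡0 Vh≢0) Vh≡Th)) Th≢T'h
        λ Tf≡Rf → Vf≢Tf (sym (trans Tf≡Rf (R≡V f Zf≡0 Vf≢0)))

  -- Z comes from strong elimination at f; it agrees with T off Sep(T, T'), and the sign of Z at h
  -- decides which tope above Z separates f from h.
  descent-via : ∀ {T T' Z} → Tope L T → Tope L T' → ∀ {f h} → f ≢ h → T f ≢ T' f → T h ≢ T' h →
                Z ∈ᴸ L → Z f ≡ zer → (∀ j → T j ≡ T' j → Z j ≡ T j) → DescentStep T T'
  descent-via {T} {T'} {Z} tT tT' {f} {h} f≢h Tf≢T'f Th≢T'h Z∈L Zf≡0 Z-agrees with Z h ≟ˢ zer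
  ... | yes Zh≡0 = descent-via-zero tT f≢h Tf≢T'f Th≢T'h Z∈L Zf≡0 Zh≡0 Z-agrees
  ... | no Zh≢0 with Z h ≟ˢ T h
  ...   | yes Zh≡Th = descent-above tT Z-agrees (∘ᵛ-tope Z∈L tT') (≤ᵛ-∘ᵛ Z T') h f
                        (sym (trans (∘ᵛ-nonzero Z T' h Zh≢0) Zh≡Th)) Th≢T'h
                        (λ Tf≡Rf → Tf≢T'f (trans Tf≡Rf (∘ᵛ-zer Z T' f Zf≡0)))
  ...   | no Zh≢Th  = descent-above tT Z-agrees (∘ᵛ-tope Z∈L tT) (≤ᵛ-∘ᵛ Z T) f h
                        (sym (∘ᵛ-zer Z T f Zf≡0)) Tf≢T'f
                        (λ Th≡Rh → Zh≢Th (sym (trans Th≡Rh (∘ᵛ-nonzero Z T h Zh≢0))))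

  descent : ∀ {T T'} → Tope L T → Tope L T' → ∀ {f h} → f ≢ h → T f ≢ T' f → T h ≢ T' h →
            DescentStep T T'
  descent {T} {T'} tT tT' {f} f≢h Tf≢T'f Th≢T'h
    with se T T' (proj₁ tT) (proj₁ tT') f (·ˢ-opposite (tope⇒total tT f) (tope⇒total tT' f) Tf≢T'f)
  ... | Z , Z∈L , Zf≡0 , Z-off = descent-via tT tT' f≢h Tf≢T'f Th≢T'h Z∈L Zf≡0 Z-agrees
    where
    Z-agrees : ∀ j → T j ≡ T' j → Z j ≡ T j
    Z-agrees j Tj≡T'j = trans (Z-off j not-sep) (∘ᵛ-nonzero T T' j (tope⇒total tT j))
      where
      not-sep : ¬ Sep T T' j
      not-sep sep = ·ˢ-self≢neg (T j) (subst (λ s → T j ·ˢ s ≡ neg) (sym Tj≡T'j) sep)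

  neighbour-towards : ∀ {T T'} → Tope L T → Tope L T' → ∀ {f} → T f ≢ T' f →
                      ∃[ T'' ] ∃[ g ] (Tope L T'' × DiffOnlyAt T T'' g × T g ≢ T' g)
  neighbour-towards tT tT' = go tT tT' (⊂-wellFounded _)
    where
    go : ∀ {T T'} → Tope L T → Tope L T' → Acc _⊂_ (diff T T') → ∀ {f} → T f ≢ T' f →
         ∃[ T'' ] ∃[ g ] (Tope L T'' × DiffOnlyAt T T'' g × T g ≢ T' g)
    go {T} {T'} tT tT' (acc smaller) {f} Tf≢T'f with any? (λ h → ¬? (h ≟ᶠ f) ×-dec ¬? (T h ≟ˢ T' h))
    ... | no only-f =
      T' , f , tT' , (Tf≢T'f , λ h Th≢T'h → decidable-stable (h ≟ᶠ f) λ h≢f → only-f (h , h≢f , Th≢T'h)) ,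
      Tf≢T'f
    ... | yes (h , h≢f , Th≢T'h) with descent tT tT' (λ f≡h → h≢f (sym f≡h)) Tf≢T'f Th≢T'h
    ...   | R , tR , R⊂T' , b , Tb≢Rb with go tT tR (smaller R⊂T') Tb≢Rb
    ...     | T'' , g , tT'' , adj , Tg≢Rg =
      T'' , g , tT'' , adj , ∈-diff⁻ T T' g (proj₁ R⊂T' (∈-diff⁺ T R g Tg≢Rg))

  neighbour-value : ∀ {v v' T g} → Tope L v → Tope L v' → Tope L T → DiffOnlyAt v T g → v g ≢ v' g →
                    T g ≡ v' g
  neighbour-value {g = g} tv tv' tT adj vg≢v'g =
    third-sign (tope⇒total tv g) (tope⇒total tv' g) (tope⇒total tT g) vg≢v'g (proj₁ adj)

  neighbour-⊂ : ∀ {v v' T g} → Tope L v → Tope L v' → Tope L T → DiffOnlyAt v T g → v g ≢ v' g →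
                diff T v' ⊂ diff v v'
  neighbour-⊂ {v} {v'} {T} {g} tv tv' tT adj vg≢v'g =
    diff-⊂ T v' v v' moves-inside g (neighbour-value tv tv' tT adj vg≢v'g) vg≢v'g
    where
    moves-inside : ∀ j → T j ≢ v' j → v j ≢ v' j
    moves-inside j Tj≢v'j with j ≟ᶠ g
    ... | yes refl = vg≢v'g
    ... | no j≢g   = λ vj≡v'j → Tj≢v'j (trans (sym (DiffOnlyAt-agree adj j j≢g)) vj≡v'j)

  -- The edge crossing e on a geodesic from v to v': x and x' keep the coordinates that v and v'
  -- share, and the values of v and v' at e.
  crossing-edge : ∀ {v v'} → Tope L v → Tope L v' → ∀ {e} → v e ≢ v' e →
                  ∃[ x ] ∃[ x' ] (Tope L x × Tope L x' × DiffOnlyAt x x' e ×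
                                  (∀ j → j ≡ e ⊎ v j ≡ v' j → x j ≡ v j × x' j ≡ v' j))
  crossing-edge tv tv' = go tv tv' (⊂-wellFounded _)
    where
    go : ∀ {v v'} → Tope L v → Tope L v' → Acc _⊂_ (diff v v') → ∀ {e} → v e ≢ v' e →
         ∃[ x ] ∃[ x' ] (Tope L x × Tope L x' × DiffOnlyAt x x' e ×
                         (∀ j → j ≡ e ⊎ v j ≡ v' j → x j ≡ v j × x' j ≡ v' j))
    go {v} {v'} tv tv' (acc smaller) {e} ve≢v'e with neighbour-towards tv tv' ve≢v'e
    ... | T , g , tT , adj , vg≢v'g with g ≟ᶠ e
    ...   | yes refl = v , T , tv , tT , adj , λ j fixed → refl , T≡v' j fixed
      where
      T≡v' : ∀ j → j ≡ g ⊎ v j ≡ v' j → T j ≡ v' j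
      T≡v' j (inj₁ refl) = neighbour-value tv tv' tT adj vg≢v'g
      T≡v' j (inj₂ vj≡v'j) with j ≟ᶠ g
      ... | yes refl = contradiction vj≡v'j vg≢v'g
      ... | no j≢g   = trans (sym (DiffOnlyAt-agree adj j j≢g)) vj≡v'j
    ...   | no g≢e
      with go tT tv' (smaller (neighbour-⊂ tv tv' tT adj vg≢v'g))
              (λ Te≡v'e → ve≢v'e (trans (DiffOnlyAt-agree adj e (λ e≡g → g≢e (sym e≡g))) Te≡v'e))
    ...     | x , x' , tx , tx' , adj' , fixed = x , x' , tx , tx' , adj' , fixed'
      where
      fixed' : ∀ j → j ≡ e ⊎ v j ≡ v' j → x j ≡ v j × x' j ≡ v' j
      fixed' j hyp = map₁ (λ xj≡Tj → trans xj≡Tj (sym vj≡Tj)) (fixed j (map₂ (trans (sym vj≡Tj)) hyp))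
        where
        off-g : j ≢ g
        off-g refl = [ g≢e , vg≢v'g ]′ hyp
        vj≡Tj : v j ≡ T j
        vj≡Tj = DiffOnlyAt-agree adj j off-g

  contracted-edge : ∀ A {u w} → Adj (contract A (TopeGraph L)) u w → Adj (TopeGraph (delete L A)) u w
  contracted-edge A {u} {w} (u≢w , v , v' , (tv , tv' , e , adj) , vA≐u , v'A≐w) =
    restrict-tope A tv vA≐u , restrict-tope A tv' v'A≐w ,
    e , DiffOnlyAt-cong vA≐u v'A≐w (restrict-DiffOnlyAt A v v' e e∉A adj)
    where
    e∉A : lookup A e ≡ false
    e∉A with ¬∀⟶∃¬ n (λ j → u j ≡ w j) (λ j → u j ≟ˢ w j) u≢w
    ... | f , uf≢wf with restrict-≢⁻ A v v' f (≢-resp-≐ (≐-sym vA≐u) (≐-sym v'A≐w) f uf≢wf)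
    ... | vf≢v'f , f∉A = subst (λ k → lookup A k ≡ false) (proj₂ adj f vf≢v'f) f∉A

  lifted-edge : ∀ A {u w} → Adj (TopeGraph (delete L A)) u w → Adj (contract A (TopeGraph L)) u w
  lifted-edge A {u} {w} (tu , tw , e , adj) with tope-lift A tu | tope-lift A tw
  ... | v , tv , vA≐u | v' , tv' , v'A≐w
    with restrict-≢⁻ A v v' e (≢-resp-≐ (≐-sym vA≐u) (≐-sym v'A≐w) e (proj₁ adj))
  ... | ve≢v'e , _ with crossing-edge tv tv' ve≢v'e
  ... | x , x' , tx , tx' , adj-x , fixed =
    (λ u≐w → proj₁ adj (u≐w e)) , x , x' , (tx , tx' , e , adj-x) ,
    ≐-trans (restrict-≐ A λ j j∉A → proj₁ (fixed j (kept j j∉A))) vA≐u ,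
    ≐-trans (restrict-≐ A λ j j∉A → proj₂ (fixed j (kept j j∉A))) v'A≐w
    where
    kept : ∀ j → lookup A j ≡ false → j ≡ e ⊎ v j ≡ v' j
    kept j j∉A with v j ≟ˢ v' j
    ... | yes vj≡v'j = inj₂ vj≡v'j
    ... | no vj≢v'j  = inj₁ (proj₂ adj j (≢-resp-≐ vA≐u v'A≐w j (restrict-≢⁺ A v v' j j∉A vj≢v'j)))

  contract-TopeGraph : (A : Subset n) → SameGraph (contract A (TopeGraph L)) (TopeGraph (delete L A))
  contract-TopeGraph A =
    (λ w → mk⇔ (λ (v , tv , vA≐w) → restrict-tope A tv vA≐w) (tope-lift A)) ,
    (λ u w → mk⇔ (contracted-edge A) (lifted-edge A))

  face-UIso : ∀ X → X ∈ᴸ L → UIso (FaceGraph L X) (TopeGraph (delete L (supp X)))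
  face-UIso X X∈L = record
    { φ      = restrict (supp X)
    ; φ-cong = λ _ _ _ → restrict-cong (supp X)
    ; φ-vert = λ _ (tv , _) → restrict-tope (supp X) tv ≐-refl
    ; φ-inj  = λ _ _ (_ , X≤u) (_ , X≤v) → face-restrict-injective X≤u X≤v
    ; φ-surj = lift
    ; φ-adj  = λ u v fu fv → mk⇔ (restricted-edge u v fu fv) (face-edge u v fu fv)
    ; φ-Θ    = λ u v ((_ , X≤u) , (_ , X≤v) , _) e ue≢ve →
                 restrict-≢⁺ (supp X) u v e (≤ᵛ-disagree-supp X≤u X≤v e ue≢ve) ue≢ve
    }
    where
    lift : ∀ w → Tope (delete L (supp X)) w → ∃[ v ] ((Tope L v × X ≤ᵛ v) × restrict (supp X) v ≐ w)
    lift w tw with tope-lift (supp X) tw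
    ... | v , tv , vX≐w =
      X ∘ᵛ v , (∘ᵛ-tope X∈L tv , ≤ᵛ-∘ᵛ X v) ,
      ≐-trans (restrict-≐ (supp X) λ e e∉supp → ∘ᵛ-zer X v e (supp-zer⁻ X e e∉supp)) vX≐w
    restricted-edge : ∀ u v → Vert (FaceGraph L X) u → Vert (FaceGraph L X) v → Adj (FaceGraph L X) u v →
                      Adj (TopeGraph (delete L (supp X))) (restrict (supp X) u) (restrict (supp X) v)
    restricted-edge u v (tu , X≤u) (tv , X≤v) (_ , _ , e , adj) =
      restrict-tope (supp X) tu ≐-refl , restrict-tope (supp X) tv ≐-refl ,
      e , restrict-DiffOnlyAt (supp X) u v e (≤ᵛ-disagree-supp X≤u X≤v e (proj₁ adj)) adj
    face-edge : ∀ u v → Vert (FaceGraph L X) u → Vert (FaceGraph L X) v →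
                Adj (TopeGraph (delete L (supp X))) (restrict (supp X) u) (restrict (supp X) v) →
                Adj (FaceGraph L X) u v
    face-edge u v fu@(_ , X≤u) fv@(_ , X≤v) (_ , _ , e , adj) =
      fu , fv , e , restrict-DiffOnlyAt⁻ (supp X) u v e (≤ᵛ-disagree-supp X≤u X≤v) adj

lemma10 : (n : ℕ) (L : SignSystem {n}) → IsCOM L →
    ((A : Subset n) → SameGraph (contract A (TopeGraph L)) (TopeGraph (delete L A)))
    × (∀ X → X ∈ᴸ L →
         UIso (FaceGraph L X) (TopeGraph (delete L (supp X)))
         × SameGraph (TopeGraph (delete L (supp X))) (contract (supp X) (TopeGraph L)))
lemma10 n L com =
  contract-TopeGraph , λ X X∈L → face-UIso X X∈L , SameGraph-sym (contract-TopeGraph (supp X))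
  where open COM com
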